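{- Let $T$ be a complete theory. If a partitioned formula $\varphi(x;y)$ is $\mathrm{PM}$ in $T$, then $\varphi(x;y)$ is $\mathrm{CM}$ in $T$.
   Context: Identify $n<\omega$ with $\{0,\dots,n-1\}$. An $n$-pattern is $(\mathcal{C},\mathcal{I})$ with $\mathcal{C},\mathcal{I}\subseteq(\mathcal{P}(n)\times\mathcal{P}(n))\setminus\{(\emptyset,\emptyset)\}$. $\varphi$ exhibits it in $T$ if there are $b_0,\dots,b_{n-1}$ in a monster model of $T$ such that for each $(A^+,A^-)\in\mathcal{C}$ the type $\{\varphi(x;b_i):i\in A^+\}\cup\{\neg\varphi(x;b_j):j\in A^-\}$ is consistent and for each $(Z^+,Z^-)\in\mathcal{I}$ the analogous type is inconsistent. A pattern is reasonable if (i) for all $(Z^+,Z^-)\in\mathcal{I}$, $(Y^+,Y^-)\in\mathcal{C}$ there is $\epsilon\in\{+,-\}$ with $Z^\epsilon\not\subseteq Y^\epsilon$; (ii),(iii) $X^+\cap X^-=\emptyset$ for every condition $(X^+,X^-)\in\mathcal{C}\cup\mathcal{I}$. It is positive if every condition has $X^-=\emptyset$. $\varphi$ is $\mathrm{PM}$ if for every $n$ it exhibits every reasonable positive $n$-pattern. $\varphi$ is $\mathrm{CM}$ (consistency maximal) if for every $n$ it exhibits every reasonable $n$-pattern of the form $(\mathcal{C},\emptyset)$. -}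

module Defs where

open import Data.Nat using (ℕ)
open import Data.Fin using (Fin)
open import Data.Fin.Subset using (Subset; _∈_; _⊆_; _∩_; Empty; Nonempty)
open import Data.Product using (_×_; Σ; ∃; proj₁; proj₂; _,_)
open import Data.Sum using (_⊎_)
import Data.Empty
open import Relation.Nullary using (¬_)
open import Relation.Unary using (Pred)
open import Level using (0ℓ)

-- Semantic setting: the partitioned formula φ(x;y) is represented by its
-- interpretation in the monster model 𝕄 of T, i.e. a relation
-- R ⊆ X × Y where X = 𝕄^{|x|}, Y = 𝕄^{|y|} and R a b ⇔ 𝕄 ⊨ φ(a;b).
-- A partial type over finitely many parameters is consistent iff it is
-- realized in the monster model.

Condition : ℕ → Set
Condition n = Subset n × Subset n

Conditions : ℕ → Set₁
Conditions n = Pred (Condition n) 0ℓ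

record Pattern (n : ℕ) : Set₁ where
  constructor mkPattern
  field
    𝒞 : Conditions n
    ℐ : Conditions n
open Pattern public

NonTrivial : ∀ {n} → Condition n → Set
NonTrivial (P , N) = Nonempty P ⊎ Nonempty N

WellFormed : ∀ {n} → Pattern n → Set
WellFormed p = (∀ c → 𝒞 p c → NonTrivial c) × (∀ c → ℐ p c → NonTrivial c)

Reasonable : ∀ {n} → Pattern n → Set
Reasonable p =
  (∀ Z Y → ℐ p Z → 𝒞 p Y →
     (¬ (proj₁ Z ⊆ proj₁ Y)) ⊎ (¬ (proj₂ Z ⊆ proj₂ Y)))
  × (∀ X → 𝒞 p X → Empty (proj₁ X ∩ proj₂ X))
  × (∀ X → ℐ p X → Empty (proj₁ X ∩ proj₂ X))

Positive : ∀ {n} → Pattern n → Set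
Positive p = (∀ X → 𝒞 p X → Empty (proj₂ X)) × (∀ X → ℐ p X → Empty (proj₂ X))

ConsistentType : ∀ {X Y : Set} (R : X → Y → Set) {n} → (Fin n → Y) → Condition n → Set
ConsistentType {X} R b (P , N) =
  Σ X λ a → (∀ i → i ∈ P → R a (b i)) × (∀ j → j ∈ N → ¬ R a (b j))

Exhibits : ∀ {X Y : Set} (R : X → Y → Set) {n} → Pattern n → Set
Exhibits {X} {Y} R {n} p =
  Σ (Fin n → Y) λ b →
    (∀ c → 𝒞 p c → ConsistentType R b c) ×
    (∀ c → ℐ p c → ¬ ConsistentType R b c)

PM : ∀ {X Y : Set} (R : X → Y → Set) → Set₁
PM R = ∀ n (p : Pattern n) → WellFormed p → Reasonable p → Positive p → Exhibits R p

∅ᶜ : ∀ {n} → Conditions n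
∅ᶜ _ = Data.Empty.⊥

CM : ∀ {X Y : Set} (R : X → Y → Set) → Set₁
CM R = ∀ n (𝒞₀ : Conditions n) → WellFormed (mkPattern 𝒞₀ ∅ᶜ) → Reasonable (mkPattern 𝒞₀ ∅ᶜ)
       → Exhibits R (mkPattern 𝒞₀ ∅ᶜ)

{-# OPTIONS --safe #-}
module Submission where

-- Double the parameters: alongside each b_i take a second parameter b'_i with
-- {φ(x;b_i), φ(x;b'_i)} inconsistent, so that φ(x;b'_i) implies ¬φ(x;b_i).  A
-- condition (A⁺, A⁻) then becomes the positive condition A⁺ ∪ {b'_j : j ∈ A⁻}.
-- The resulting positive pattern is reasonable because A⁺ ∩ A⁻ = ∅, so PM
-- exhibits it, and any realisation of the translate of (A⁺, A⁻) realises
-- (A⁺, A⁻) itself over b_0, …, b_{n-1}.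

open import Defs
open import Data.Nat using (ℕ; _+_)
open import Data.Fin using (Fin; zero; suc; _↑ˡ_; _↑ʳ_)
open import Data.Fin.Subset using (Subset; _∈_; _⊆_; _∩_; Empty; ⊥; ⁅_⁆)
open import Data.Fin.Subset.Properties using (∉⊥; x∈⁅x⁆; x∈⁅y⁆⇒x≡y; x∈p∩q⁺; x∈p∩q⁻)
open import Data.Vec using ([]; _∷_; _++_; here; there)
open import Data.Vec.Properties using ([]=⇒lookup; lookup⇒[]=; lookup-++ˡ; lookup-++ʳ)
open import Data.Product using (∃-syntax; proj₁; proj₂; _,_; _×_)
open import Data.Sum using (inj₁; inj₂)
open import Data.Empty using (⊥-elim)
open import Function using (_∘_)
open import Relation.Nullary using (¬_)
open import Relation.Binary.PropositionalEquality using (_≡_; refl; sym; trans; subst)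

module _ {m n : ℕ} (P : Subset m) (Q : Subset n) where

  ∈-++⁺ˡ : ∀ {i} → i ∈ P → i ↑ˡ n ∈ P ++ Q
  ∈-++⁺ˡ {i} i∈P = lookup⇒[]= (i ↑ˡ n) (P ++ Q) (trans (lookup-++ˡ P Q i) ([]=⇒lookup i∈P))

  ∈-++⁺ʳ : ∀ {j} → j ∈ Q → m ↑ʳ j ∈ P ++ Q
  ∈-++⁺ʳ {j} j∈Q = lookup⇒[]= (m ↑ʳ j) (P ++ Q) (trans (lookup-++ʳ P Q j) ([]=⇒lookup j∈Q))

  ∈-++⁻ˡ : ∀ {i} → i ↑ˡ n ∈ P ++ Q → i ∈ P
  ∈-++⁻ˡ {i} i∈ = lookup⇒[]= i P (trans (sym (lookup-++ˡ P Q i)) ([]=⇒lookup i∈))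

  ∈-++⁻ʳ : ∀ {j} → m ↑ʳ j ∈ P ++ Q → j ∈ Q
  ∈-++⁻ʳ {j} j∈ = lookup⇒[]= j Q (trans (sym (lookup-++ʳ P Q j)) ([]=⇒lookup j∈))

∈-++-elim : ∀ {m n} (S : Fin (m + n) → Set) (P : Subset m) {Q : Subset n} →
            (∀ i → i ∈ P → S (i ↑ˡ n)) → (∀ j → j ∈ Q → S (m ↑ʳ j)) →
            ∀ k → k ∈ P ++ Q → S k
∈-++-elim S []      onP onQ k       k∈  = onQ k k∈
∈-++-elim S (_ ∷ P) onP onQ zero    here = onP zero here
∈-++-elim S (_ ∷ P) onP onQ (suc k) (there k∈) =
  ∈-++-elim (S ∘ suc) P (λ i → onP (suc i) ∘ there) onQ k k∈

⊥-Empty : ∀ {n} → Empty (⊥ {n})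
⊥-Empty (_ , x∈⊥) = ∉⊥ x∈⊥

∩⊥-Empty : ∀ {n} (P : Subset n) → Empty (P ∩ ⊥)
∩⊥-Empty P (x , x∈) = ∉⊥ (proj₂ (x∈p∩q⁻ P ⊥ x∈))

module PositiveEncoding {n : ℕ} where

  encode : Condition n → Condition (n + n)
  encode (P , N) = P ++ N , ⊥

  clash : Fin n → Condition (n + n)
  clash i = ⁅ i ⁆ ++ ⁅ i ⁆ , ⊥

  encoded : Conditions n → Pattern (n + n)
  encoded 𝒞₀ = mkPattern (λ c → ∃[ A ] 𝒞₀ A × c ≡ encode A) (λ c → ∃[ i ] c ≡ clash i)

  clash-⊆⇒∈∩ : ∀ {i} (P N : Subset n) → proj₁ (clash i) ⊆ P ++ N → i ∈ P ∩ N
  clash-⊆⇒∈∩ {i} P N sub = x∈p∩q⁺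
    ( ∈-++⁻ˡ P N (sub (∈-++⁺ˡ ⁅ i ⁆ ⁅ i ⁆ (x∈⁅x⁆ i)))
    , ∈-++⁻ʳ P N (sub (∈-++⁺ʳ ⁅ i ⁆ ⁅ i ⁆ (x∈⁅x⁆ i))))

  encoded-wellFormed : ∀ {𝒞₀} → (∀ c → 𝒞₀ c → NonTrivial c) → WellFormed (encoded 𝒞₀)
  encoded-wellFormed nonTrivial = encode-nonTrivial , clash-nonTrivial
    where
    encode-nonTrivial : ∀ c → (∃[ A ] _ × c ≡ encode A) → NonTrivial c
    encode-nonTrivial _ ((P , N) , A∈ , refl) with nonTrivial (P , N) A∈
    ... | inj₁ (i , i∈P) = inj₁ (i ↑ˡ n , ∈-++⁺ˡ P N i∈P)
    ... | inj₂ (j , j∈N) = inj₁ (n ↑ʳ j , ∈-++⁺ʳ P N j∈N)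
    clash-nonTrivial : ∀ c → (∃[ i ] c ≡ clash i) → NonTrivial c
    clash-nonTrivial _ (i , refl) = inj₁ (i ↑ˡ n , ∈-++⁺ˡ ⁅ i ⁆ ⁅ i ⁆ (x∈⁅x⁆ i))

  encoded-reasonable : ∀ {𝒞₀} → (∀ X → 𝒞₀ X → Empty (proj₁ X ∩ proj₂ X)) → Reasonable (encoded 𝒞₀)
  encoded-reasonable disjoint =
      (λ { _ _ (i , refl) ((P , N) , A∈ , refl) →
             inj₁ λ sub → disjoint (P , N) A∈ (i , clash-⊆⇒∈∩ P N sub) })
    , (λ { _ ((P , N) , _ , refl) → ∩⊥-Empty (P ++ N) })
    , (λ { _ (i , refl) → ∩⊥-Empty (⁅ i ⁆ ++ ⁅ i ⁆) })

  encoded-positive : ∀ {𝒞₀} → Positive (encoded 𝒞₀)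
  encoded-positive = (λ { _ (_ , _ , refl) → ⊥-Empty }) , (λ { _ (_ , refl) → ⊥-Empty })

  module _ {X Y : Set} (R : X → Y → Set) where

    clash-excludes : ∀ {b : Fin (n + n) → Y} {a} j → ¬ ConsistentType R b (clash j) →
                     R a (b (n ↑ʳ j)) → ¬ R a (b (j ↑ˡ n))
    clash-excludes {b} {a} j inconsistent Rab' Rab = inconsistent
      ( a
      , ∈-++-elim (R a ∘ b) ⁅ j ⁆
          (λ i i∈ → subst (R a ∘ b ∘ (_↑ˡ n)) (sym (x∈⁅y⁆⇒x≡y j i∈)) Rab)
          (λ i i∈ → subst (R a ∘ b ∘ (n ↑ʳ_)) (sym (x∈⁅y⁆⇒x≡y j i∈)) Rab')
      , λ _ → ⊥-elim ∘ ∉⊥)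

    encoded-exhibits⇒exhibits : ∀ {𝒞₀} → Exhibits R (encoded 𝒞₀) → Exhibits R (mkPattern 𝒞₀ ∅ᶜ)
    encoded-exhibits⇒exhibits {𝒞₀} (b , consistent , inconsistent) =
      b ∘ (_↑ˡ n) , decode , λ _ ()
      where
      decode : ∀ c → 𝒞₀ c → ConsistentType R (b ∘ (_↑ˡ n)) c
      decode (P , N) A∈ with consistent (encode (P , N)) ((P , N) , A∈ , refl)
      ... | a , realises , _ =
        a , (λ i → realises (i ↑ˡ n) ∘ ∈-++⁺ˡ P N)
          , λ j j∈N → clash-excludes j (inconsistent (clash j) (j , refl))
                                       (realises (n ↑ʳ j) (∈-++⁺ʳ P N j∈N))

proposition5p12 : {X Y : Set} (R : X → Y → Set) → PM R → CM R
proposition5p12 R pm n 𝒞₀ (nonTrivial , _) (_ , disjoint , _) =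
  encoded-exhibits⇒exhibits R
    (pm (n + n) (encoded 𝒞₀) (encoded-wellFormed nonTrivial) (encoded-reasonable disjoint) encoded-positive)
  where open PositiveEncoding
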